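{- Let $N\in{}^*\mathbb{N}$ be infinite, $V\subseteq[1,N]$ a multiplicative cut, and $a\in{}^*\mathbb{N}$. Then: (1) if $x,y\in[a]^V$ and $x<y$, then $[x,y]\subseteq[a]^V$; (2) $[a]^V=\bigcup_{x\in V}[\lfloor ax^{ -1}\rfloor, ax]$.
   Context: Nonstandard setting: ${}^*\mathbb{N}$ hypernaturals, intervals are sets of hypernaturals. A multiplicative cut is an infinite initial segment $V$ of ${}^*\mathbb{N}$ with $V\cdot V\subseteq V$. For $a,b$ define $a\sim_V b$ iff $|\lfloor\ln a\rfloor-\lfloor\ln b\rfloor|\in\ln V$, where $\ln V=\{x\in{}^*\mathbb{N}\cup\{0\}:\lfloor e^x\rfloor\in V\}$; equivalently, for $a<b$, $a\sim_V b$ iff $\lfloor b/a\rfloor\in V$. This is an equivalence relation and $[a]^V=\{x\in{}^*\mathbb{N}: a\sim_V x\}$. -}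

module Defs where

open import Data.Nat using (ℕ; zero; suc; _+_; _*_; _∸_; _≤_; _<_; _⊔_; _⊓_)
open import Data.Nat.DivMod using (_/_)
open import Data.Product using (Σ; _×_; _,_; ∃-syntax)
open import Data.Sum using (_⊎_)
open import Data.Empty using (⊥)
open import Data.Unit using (⊤)
open import Relation.Nullary using (¬_)
open import Relation.Binary.PropositionalEquality using (_≡_)

record NPUltrafilter : Set₁ where
  field
    U        : (ℕ → Set) → Set
    U-full   : U (λ _ → ⊤)
    U-proper : ¬ U (λ _ → ⊥)
    U-mono   : ∀ {A B : ℕ → Set} → (∀ n → A n → B n) → U A → U B
    U-inter  : ∀ {A B : ℕ → Set} → U A → U B → U (λ n → A n × B n)
    U-ultra  : ∀ (A : ℕ → Set) → U A ⊎ U (λ n → ¬ A n)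
    U-nonpr  : ∀ (k : ℕ) → U (λ n → k < n)

module Hyper (F : NPUltrafilter) where
  open NPUltrafilter F

  -- Hypernaturals: the ultrapower ℕ^ℕ / F, represented by sequences,
  -- with equality, order and operations taken F-almost everywhere / pointwise.
  Hyp : Set
  Hyp = ℕ → ℕ

  _≈_ : Hyp → Hyp → Set
  x ≈ y = U (λ n → x n ≡ y n)

  _≤*_ : Hyp → Hyp → Set
  x ≤* y = U (λ n → x n ≤ y n)

  _<*_ : Hyp → Hyp → Set
  x <* y = U (λ n → x n < y n)

  std : ℕ → Hyp
  std k = λ _ → k

  _·_ : Hyp → Hyp → Hyp
  (x · y) n = x n * y n

  -- truncated division, agreeing with ⌊m/k⌋ whenever k ≥ 1
  _÷_ : Hyp → Hyp → Hyp
  (x ÷ y) n = x n / suc (y n ∸ 1)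

  -- membership in *ℕ = {1,2,...} (positive hypernaturals)
  InNStar : Hyp → Set
  InNStar x = std 1 ≤* x

  Infinite : Hyp → Set
  Infinite N = ∀ (k : ℕ) → std k <* N

  record MultCut (N : Hyp) (V : Hyp → Set) : Set where
    field
      resp     : ∀ {x y} → x ≈ y → V x → V y
      sub1N    : ∀ {x} → V x → InNStar x × x ≤* N
      initial  : ∀ {x y} → InNStar x → x ≤* y → V y → V x
      infinite : ∀ (k : ℕ) → ∃[ x ] (V x × std k <* x)
      mult     : ∀ {x y} → V x → V y → V (x · y)

  Sim : (V : Hyp → Set) → Hyp → Hyp → Set
  Sim V a b = V (λ n → (a n ⊔ b n) / suc ((a n ⊓ b n) ∸ 1))

  Class : (V : Hyp → Set) → Hyp → Hyp → Set
  Class V a x = InNStar x × Sim V a x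

-- The ratio ⌊max(a,z)/min(a,z)⌋ decreases in z on [1, a] and increases on [a, ∞), so on
-- [x, y] it is bounded by its value at an endpoint, hence by the product of the two endpoint
-- values; as V is an initial segment closed under products, [a]^V is convex.  Moreover
-- a/x ≤ z ≤ a·x holds as soon as the ratio of a and z is below x, and conversely forces it
-- below 2x; a fixed k ∈ V with k > 1 absorbs this slack in both directions, so [a]^V is the
-- union of the intervals [a/x, a·x] over x ∈ V.
module Submission where

open import Defs
open import Data.Nat
open import Data.Nat.Properties
open import Data.Nat.DivMod
open import Data.Product using (_×_; _,_; ∃-syntax; proj₁; proj₂)
open import Data.Sum using (inj₁; inj₂)
open import Function.Bundles using (_⇔_; mk⇔)
open import Relation.Binary.PropositionalEquality using (_≡_; refl; trans; cong)

m/o<n⇒m<n*o : ∀ {m n o} .{{_ : NonZero o}} → m / o < n → m < n * o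
m/o<n⇒m<n*o {m} {n} {o} m/o<n = begin-strict
  m                 ≡⟨ m≡m%n+[m/n]*n m o ⟩
  m % o + m / o * o <⟨ +-monoˡ-< (m / o * o) (m%n<n m o) ⟩
  suc (m / o) * o   ≤⟨ *-monoˡ-≤ o m/o<n ⟩
  n * o             ∎
  where open ≤-Reasoning

m⊔n≤m*n : ∀ {m n} → 0 < m → 0 < n → m ⊔ n ≤ m * n
m⊔n≤m*n {m} {n} m>0 n>0 =
  ⊔-lub (m≤m*n m n {{>-nonZero n>0}}) (m≤n*m n m {{>-nonZero m>0}})

ratio : ℕ → ℕ → ℕ
ratio a b = (a ⊔ b) / suc ((a ⊓ b) ∸ 1)

ratio-comm : ∀ a b → ratio a b ≡ ratio b a
ratio-comm a b rewrite ⊔-comm a b | ⊓-comm a b = refl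

ratio-≤ : ∀ {a b} → a ≤ b → ratio a b ≡ b / suc (a ∸ 1)
ratio-≤ a≤b rewrite m≤n⇒m⊔n≡n a≤b | m≤n⇒m⊓n≡m a≤b = refl

ratio-≥ : ∀ {a b} → b ≤ a → ratio a b ≡ a / suc (b ∸ 1)
ratio-≥ {a} {b} b≤a = trans (ratio-comm a b) (ratio-≤ b≤a)

ratio>0 : ∀ {a b} → 0 < a → 0 < b → 0 < ratio a b
ratio>0 {suc a} {suc b} _ _ with ≤-total a b
... | inj₁ a≤b rewrite ratio-≤ (s≤s a≤b) = m≥n⇒m/n>0 (s≤s a≤b)
... | inj₂ b≤a rewrite ratio-≥ (s≤s b≤a) = m≥n⇒m/n>0 (s≤s b≤a)

ratio-between : ∀ a {x y z} → x ≤ z → z ≤ y → ratio a z ≤ ratio a x ⊔ ratio a y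
ratio-between a {x} {y} {z} x≤z z≤y with ≤-total a z
... | inj₁ a≤z = begin
  ratio a z         ≡⟨ ratio-≤ a≤z ⟩
  z / suc (a ∸ 1)   ≤⟨ /-monoˡ-≤ (suc (a ∸ 1)) z≤y ⟩
  y / suc (a ∸ 1)   ≡⟨ ratio-≤ (≤-trans a≤z z≤y) ⟨
  ratio a y         ≤⟨ m≤n⊔m (ratio a x) (ratio a y) ⟩
  ratio a x ⊔ ratio a y ∎
  where open ≤-Reasoning
... | inj₂ z≤a = begin
  ratio a z         ≡⟨ ratio-≥ z≤a ⟩
  a / suc (z ∸ 1)   ≤⟨ /-monoʳ-≤ a (s≤s (∸-monoˡ-≤ 1 x≤z)) ⟩
  a / suc (x ∸ 1)   ≡⟨ ratio-≥ (≤-trans x≤z z≤a) ⟨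
  ratio a x         ≤⟨ m≤m⊔n (ratio a x) (ratio a y) ⟩
  ratio a x ⊔ ratio a y ∎
  where open ≤-Reasoning

ratio-≤-* : ∀ {a x y z} → 0 < a → 0 < x → 0 < y → x ≤ z → z ≤ y →
            ratio a z ≤ ratio a x * ratio a y
ratio-≤-* {a} a>0 x>0 y>0 x≤z z≤y =
  ≤-trans (ratio-between a x≤z z≤y) (m⊔n≤m*n (ratio>0 a>0 x>0) (ratio>0 a>0 y>0))

ratio<⇒∈[a/x,a*x] : ∀ {a x z} → 0 < a → 0 < z → ratio a z < x →
                   a / suc (x ∸ 1) ≤ z × z ≤ a * x
ratio<⇒∈[a/x,a*x] {a@(suc _)} {x@(suc _)} {z@(suc _)} _ _ r<x with ≤-total a z
... | inj₁ a≤z rewrite ratio-≤ a≤z =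
  ≤-trans (m/n≤m a x) a≤z ,
  <⇒≤ (<-≤-trans (m/o<n⇒m<n*o {z} {x} {a} r<x) (≤-reflexive (*-comm x a)))
... | inj₂ z≤a rewrite ratio-≥ z≤a =
  <⇒≤ (m<n*o⇒m/o<n (<-≤-trans (m/o<n⇒m<n*o {a} {x} {z} r<x) (≤-reflexive (*-comm x z)))) ,
  ≤-trans z≤a (m≤m*n a x)

∈[a/x,a*x]⇒ratio< : ∀ {a x z} → 0 < a → 0 < x → 0 < z →
                   a / suc (x ∸ 1) ≤ z → z ≤ a * x → ratio a z < 2 * x
∈[a/x,a*x]⇒ratio< {a@(suc _)} {x@(suc _)} {z@(suc _)} _ _ _ a/x≤z z≤a*x with ≤-total a z
... | inj₁ a≤z = begin-strict
  ratio a z ≡⟨ ratio-≤ a≤z ⟩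
  z / a     ≤⟨ /-monoˡ-≤ a z≤a*x ⟩
  a * x / a ≡⟨ cong (_/ a) (*-comm a x) ⟩
  x * a / a ≡⟨ m*n/n≡m x a ⟩
  x         <⟨ m<m*n x 2 ≤-refl ⟩
  x * 2     ≡⟨ *-comm x 2 ⟩
  2 * x     ∎
  where open ≤-Reasoning
... | inj₂ z≤a = begin-strict
  ratio a z ≡⟨ ratio-≥ z≤a ⟩
  a / z     <⟨ m<n*o⇒m/o<n a<2x*z ⟩
  2 * x     ∎
  where
    open ≤-Reasoning
    a<2x*z : a < 2 * x * z
    a<2x*z = begin-strict
      a           <⟨ m/o<n⇒m<n*o (s≤s a/x≤z) ⟩
      suc z * x   ≤⟨ *-monoˡ-≤ x (m<m*n z 2 ≤-refl) ⟩
      z * 2 * x   ≡⟨ *-assoc z 2 x ⟩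
      z * (2 * x) ≡⟨ *-comm z (2 * x) ⟩
      2 * x * z   ∎

module _ (F : NPUltrafilter) where
  open NPUltrafilter F
  open Hyper F

  infixl 5 _∩_
  _∩_ : ∀ {A B : ℕ → Set} → U A → U B → U (λ n → A n × B n)
  _∩_ = U-inter

  U-split : ∀ {A B : ℕ → Set} → U (λ n → A n × B n) → U A × U B
  U-split A∩B = U-mono (λ _ → proj₁) A∩B , U-mono (λ _ → proj₂) A∩B

  module _ {N : Hyp} {V : Hyp → Set} (cut : MultCut N V) where
    open MultCut cut

    ratio≤*⇒Sim : ∀ {a z r} → InNStar a → InNStar z →
                    (λ n → ratio (a n) (z n)) ≤* r → V r → Sim V a z
    ratio≤*⇒Sim a>0 z>0 = initial (U-mono (λ _ (a>0 , z>0) → ratio>0 a>0 z>0) (a>0 ∩ z>0))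

    Class-convex : ∀ {a x y} → InNStar a → Class V a x → Class V a y →
                     (z : Hyp) → InNStar z → x ≤* z → z ≤* y → Class V a z
    Class-convex a>0 (x>0 , a∼x) (y>0 , a∼y) z z>0 x≤z z≤y =
      z>0 , ratio≤*⇒Sim a>0 z>0
              (U-mono (λ _ ((((a>0 , x>0) , y>0) , x≤z) , z≤y) → ratio-≤-* a>0 x>0 y>0 x≤z z≤y)
                      (a>0 ∩ x>0 ∩ y>0 ∩ x≤z ∩ z≤y))
              (mult a∼x a∼y)

    Class⇔⋃[a/x,a*x] : ∀ {a} → InNStar a → (z : Hyp) → InNStar z →
              Class V a z ⇔ (∃[ x ] (V x × ((a ÷ x) ≤* z) × (z ≤* (a · x))))
    Class⇔⋃[a/x,a*x] {a} a>0 z z>0 with infinite 1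
    ... | k , k∈V , k>1 = mk⇔ to from
      where
        to : Class V a z → ∃[ x ] (V x × ((a ÷ x) ≤* z) × (z ≤* (a · x)))
        to (_ , a∼z) = _ , mult a∼z k∈V , U-split
          (U-mono (λ n ((a>0 , z>0) , k>1) → ratio<⇒∈[a/x,a*x] a>0 z>0
                     (m<m*n (ratio (a n) (z n)) (k n) {{>-nonZero (ratio>0 a>0 z>0)}} k>1))
                  (a>0 ∩ z>0 ∩ k>1))
        from : ∃[ x ] (V x × ((a ÷ x) ≤* z) × (z ≤* (a · x))) → Class V a z
        from (x , x∈V , a/x≤z , z≤a*x) =
          z>0 , ratio≤*⇒Sim a>0 z>0
                  (U-mono (λ n (((((a>0 , x>0) , z>0) , a/x≤z) , z≤a*x) , k>1) →
                             ≤-trans (<⇒≤ (∈[a/x,a*x]⇒ratio< a>0 x>0 z>0 a/x≤z z≤a*x))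
                                     (*-monoˡ-≤ (x n) k>1))
                          (a>0 ∩ proj₁ (sub1N x∈V) ∩ z>0 ∩ a/x≤z ∩ z≤a*x ∩ k>1))
                  (mult k∈V x∈V)

proposition2p15 : (F : NPUltrafilter) → let open Hyper F in
    (N : Hyp) → Infinite N → (V : Hyp → Set) → MultCut N V →
    (a : Hyp) → InNStar a →
    ((x y : Hyp) → Class V a x → Class V a y → x <* y →
      (z : Hyp) → InNStar z → x ≤* z → z ≤* y → Class V a z)
    × ((z : Hyp) → InNStar z →
      (Class V a z ⇔ (∃[ x ] (V x × ((a ÷ x) ≤* z) × (z ≤* (a · x))))))
proposition2p15 F N _ V cut a a>0 =
  (λ x y a∼x a∼y _ → Class-convex F cut a>0 a∼x a∼y) , Class⇔⋃[a/x,a*x] F cut a>0
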